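{- Let $s>0$ and let $(v,X(v))$ be an $s$-captured edge-bundle in $C$. Then in the flow problem with source function $\Delta_{(v,X(v)),2s}$, capacity $\frac{s}{1000\delta}$ on every edge, and each vertex $u$ a sink of capacity $d(u)$, every feasible pre-flow routes at most $1.6s$ supply to sinks, i.e. $\sum_u \min(f(u),d(u))\le 1.6s$.
   Context: $C=(V,E)$ is an undirected multigraph; $d(u)$ denotes degree in $C$, $\mathrm{vol}(S)=\sum_{u\in S}d(u)$, and $\partial(S)$ is the number of edges between $S$ and $V\setminus S$. Parameters $\delta>0$ and $s_0>0$ are given. An edge-bundle $(v,X(v))$ is a set of edges sharing the endpoint $v$ (its center), written via the multiset $X(v)$ of the other endpoints. The edge-bundle is $s$-captured if there is a set $S\subseteq V$ with $\partial(S)\le\delta$, $s_0\le\mathrm{vol}(S)\le s$, and at least $\frac34|X(v)|$ of the elements of $X(v)$ (counted with multiplicity) lie in $S$ ($v$ itself may or may not be in $S$). For $\sigma>0$, $\Delta_{(v,X(v)),\sigma}(u)=\sigma\cdot\#(u,X(v))/|X(v)|$, where $\#(u,X(v))$ is the multiplicity of $u$ in $X(v)$ (the result of putting $\sigma$ supply at $v$ and pushing it evenly along the edges of the bundle). A pre-flow $f$ ($f(a,b)=-f(b,a)$, $|f(a,b)|\le$ the edge capacity on edges, $0$ on non-edges) is feasible if it is capacity-feasible and $f(u):=\Delta(u)+\sum_a f(a,u)\ge 0$ for all $u$ (source-feasible).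
   Formalization: The parameters δ, s₀ and s and the values of the pre-flow f are rational rather than real. -}

module Defs where

open import Data.Nat as ℕ using (ℕ; zero; suc)
open import Data.Fin using (Fin; zero; suc)
open import Data.Bool using (Bool; true; false; if_then_else_)
open import Data.Integer using (+_)
open import Data.Rational as ℚ using (ℚ; 0ℚ; _/_; _÷_; _≤_; _<_; positive)
open import Data.Rational.Properties using (pos⇒nonZero)
open import Data.Product using (Σ; _×_; ∃-syntax)
open import Relation.Binary.PropositionalEquality using (_≡_)

-- A finite undirected multigraph on vertex set Fin n, given by its symmetric
-- edge-multiplicity function (mult u w = number of edges between u and w;
-- mult u u = number of self-loops at u).
record Multigraph (n : ℕ) : Set where
  field
    mult : Fin n → Fin n → ℕ
    symm : ∀ u w → mult u w ≡ mult w u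
open Multigraph public

Σℕ : ∀ {n} → (Fin n → ℕ) → ℕ
Σℕ {zero} f = 0
Σℕ {suc n} f = f zero ℕ.+ Σℕ (λ i → f (suc i))

Σℚ : ∀ {n} → (Fin n → ℚ) → ℚ
Σℚ {zero} f = 0ℚ
Σℚ {suc n} f = f zero ℚ.+ Σℚ (λ i → f (suc i))

toℚ : ℕ → ℚ
toℚ k = + k / 1

VSet : ℕ → Set
VSet n = Fin n → Bool

-- degree d(u): each edge at u counts once, a self-loop counts twice
deg : ∀ {n} → Multigraph n → Fin n → ℕ
deg C u = Σℕ (mult C u) ℕ.+ mult C u u

vol : ∀ {n} → Multigraph n → VSet n → ℕ
vol C S = Σℕ (λ u → if S u then deg C u else 0)

boundary : ∀ {n} → Multigraph n → VSet n → ℕ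
boundary C S = Σℕ (λ u → if S u then Σℕ (λ w → if S w then 0 else mult C u w) else 0)

-- An edge-bundle centred at v: the multiset X(v) of other endpoints,
-- given by multiplicities #(u, X(v)); it must be a sub-multiset of the
-- edges at v.
IsBundle : ∀ {n} → Multigraph n → Fin n → (Fin n → ℕ) → Set
IsBundle C v X = ∀ u → X u ℕ.≤ mult C v u

size : ∀ {n} → (Fin n → ℕ) → ℕ
size X = Σℕ X

inSet : ∀ {n} → VSet n → (Fin n → ℕ) → ℕ
inSet S X = Σℕ (λ u → if S u then X u else 0)

Captured : ∀ {n} → Multigraph n → (δ s₀ s : ℚ) → Fin n → (Fin n → ℕ) → Set
Captured C δ s₀ s v X =
  ∃[ S ] ( toℚ (boundary C S) ≤ δ
         × s₀ ≤ toℚ (vol C S)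
         × toℚ (vol C S) ≤ s
         × ((+ 3 / 4) ℚ.* toℚ (size X)) ≤ toℚ (inSet S X) )

source : ∀ {n} → (X : Fin n → ℕ) → .{{_ : ℕ.NonZero (size X)}} → ℚ → Fin n → ℚ
source X σ u = σ ℚ.* (+ X u / size X)

edgeCap : (s δ : ℚ) → 0ℚ < δ → ℚ
edgeCap s δ δ>0 = (_÷_ s δ {{pos⇒nonZero δ {{positive δ>0}}}}) ℚ.* (+ 1 / 1000)

excess : ∀ {n} → (Fin n → ℚ) → (Fin n → Fin n → ℚ) → Fin n → ℚ
excess Δ f u = Δ u ℚ.+ Σℚ (λ a → f a u)

-- feasible pre-flow: antisymmetric, capacity-feasible (the total flow between
-- a and b is bounded by (number of a–b edges) × (per-edge capacity), hence 0
-- on non-edges), and source-feasible.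
FeasiblePreflow : ∀ {n} → Multigraph n → (cap : ℚ) → (Δ : Fin n → ℚ)
                  → (Fin n → Fin n → ℚ) → Set
FeasiblePreflow C cap Δ f =
    (∀ a b → f a b ≡ ℚ.- f b a)
  × (∀ a b → ℚ.∣ f a b ∣ ≤ toℚ (mult C a b) ℚ.* cap)
  × (∀ u → 0ℚ ≤ excess Δ f u)

routed : ∀ {n} → Multigraph n → (Fin n → ℚ) → (Fin n → Fin n → ℚ) → ℚ
routed C Δ f = Σℚ (λ u → excess Δ f u ℚ.⊓ toℚ (deg C u))

-- Let S witness that the bundle is captured.  The sinks inside S absorb at most
-- vol(S) ≤ s.  Because f is skew-symmetric, the excess left outside S is the supply
-- starting outside S, at most a quarter of the total 2s since three quarters of the
-- bundle ends in S, plus the net flow out of S, at most ∂(S)·s/(1000δ) ≤ s/1000.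
-- Hence at most (1 + 1/2 + 1/1000)s ≤ 1.6s reaches the sinks.

module Submission where

open import Defs
open import Algebra.Bundles using (CommutativeRing)
open import Data.Bool using (true; false; if_then_else_)
open import Data.Bool.Properties using (if-float)
open import Data.Fin using (Fin; zero; suc)
open import Data.Integer as ℤ using (+_)
import Data.Integer.Properties as ℤ
open import Data.Nat as ℕ using (ℕ; zero; suc; NonZero)
import Data.Nat.Properties as ℕ
open import Data.Nat.Coprimality using (1-coprimeTo) renaming (sym to coprime-sym)
open import Data.Product using (_,_)
open import Data.Rational as ℚ
  using (ℚ; mkℚ; 0ℚ; 1ℚ; _/_; _+_; _-_; _*_; -_; 1/_; _≤_; _<_; _⊓_; ∣_∣; nonNegative; positive)
open import Data.Rational.Properties
open import Data.Rational.Solver using (module +-*-Solver)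
open import Data.Sum using (inj₁; inj₂)
open import Function.Base using (_∘_)
open import Relation.Binary.PropositionalEquality
  using (_≡_; _≗_; refl; sym; trans; cong; cong₂; module ≡-Reasoning)

open import Algebra.Properties.Semiring.Sum (CommutativeRing.semiring +-*-commutativeRing)
  using (sum; sum-cong-≗; sum-replicate-zero; ∑-distrib-+; ∑-comm; *-distribˡ-sum)

Σℚ≡sum : ∀ {n} (f : Fin n → ℚ) → Σℚ f ≡ sum f
Σℚ≡sum {zero}  f = refl
Σℚ≡sum {suc n} f = cong (_+_ (f zero)) (Σℚ≡sum (f ∘ suc))

Σℚ-cong : ∀ {n} {f g : Fin n → ℚ} → f ≗ g → Σℚ f ≡ Σℚ g
Σℚ-cong {f = f} {g} f≗g = trans (Σℚ≡sum f) (trans (sum-cong-≗ f≗g) (sym (Σℚ≡sum g)))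

Σℚ-zero : ∀ n → Σℚ {n} (λ _ → 0ℚ) ≡ 0ℚ
Σℚ-zero n = trans (Σℚ≡sum {n} (λ _ → 0ℚ)) (sum-replicate-zero n)

Σℚ-distrib-+ : ∀ {n} (f g : Fin n → ℚ) → Σℚ (λ i → f i + g i) ≡ Σℚ f + Σℚ g
Σℚ-distrib-+ f g =
  trans (Σℚ≡sum (λ i → f i + g i)) (trans (∑-distrib-+ f g) (sym (cong₂ _+_ (Σℚ≡sum f) (Σℚ≡sum g))))

Σℚ-distribˡ-* : ∀ {n} (c : ℚ) (f : Fin n → ℚ) → Σℚ (λ i → c * f i) ≡ c * Σℚ f
Σℚ-distribˡ-* c f =
  trans (Σℚ≡sum (λ i → c * f i)) (trans (sym (*-distribˡ-sum c f)) (cong (c *_) (sym (Σℚ≡sum f))))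

Σℚ-comm : ∀ {m n} (h : Fin m → Fin n → ℚ) →
          Σℚ (λ i → Σℚ (λ j → h i j)) ≡ Σℚ (λ j → Σℚ (λ i → h i j))
Σℚ-comm h = begin
  Σℚ (λ i → Σℚ (h i))                ≡⟨ Σℚ-cong (λ i → Σℚ≡sum (h i)) ⟩
  Σℚ (λ i → sum (h i))               ≡⟨ Σℚ≡sum (λ i → sum (h i)) ⟩
  sum (λ i → sum (h i))              ≡⟨ ∑-comm h ⟩
  sum (λ j → sum (λ i → h i j))      ≡⟨ Σℚ≡sum (λ j → sum (λ i → h i j)) ⟨
  Σℚ (λ j → sum (λ i → h i j))       ≡⟨ Σℚ-cong (λ j → Σℚ≡sum (λ i → h i j)) ⟨
  Σℚ (λ j → Σℚ (λ i → h i j))        ∎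
  where open ≡-Reasoning

Σℚ-neg : ∀ {n} (f : Fin n → ℚ) → Σℚ (λ i → - f i) ≡ - Σℚ f
Σℚ-neg {zero}  f = refl
Σℚ-neg {suc n} f = trans (cong (_+_ (- f zero)) (Σℚ-neg (f ∘ suc))) (sym (neg-distrib-+ (f zero) _))

Σℚ-mono-≤ : ∀ {n} {f g : Fin n → ℚ} → (∀ i → f i ≤ g i) → Σℚ f ≤ Σℚ g
Σℚ-mono-≤ {zero}  f≤g = ≤-refl
Σℚ-mono-≤ {suc n} f≤g = +-mono-≤ (f≤g zero) (Σℚ-mono-≤ (f≤g ∘ suc))

-- With denominator 1 the field operations on mkℚ compute, which reduces the identities
-- below to integer identities.
toℚ≡mkℚ : ∀ k → toℚ k ≡ mkℚ (+ k) 0 (coprime-sym (1-coprimeTo k))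
toℚ≡mkℚ k = normalize-coprime (coprime-sym (1-coprimeTo k))

toℚ-+ : ∀ a b → toℚ (a ℕ.+ b) ≡ toℚ a + toℚ b
toℚ-+ a b =
  trans (cong₂ (λ x y → (x ℤ.+ y) / 1) (sym (ℤ.*-identityʳ (+ a))) (sym (ℤ.*-identityʳ (+ b))))
        (sym (cong₂ _+_ (toℚ≡mkℚ a) (toℚ≡mkℚ b)))

toℚ-Σℕ : ∀ {n} (g : Fin n → ℕ) → toℚ (Σℕ g) ≡ Σℚ (toℚ ∘ g)
toℚ-Σℕ {zero}  g = refl
toℚ-Σℕ {suc n} g = trans (toℚ-+ (g zero) _) (cong (_+_ (toℚ (g zero))) (toℚ-Σℕ (g ∘ suc)))

1/-mkℚ : ∀ k → + 1 / suc k ≡ mkℚ (+ 1) k (1-coprimeTo (suc k))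
1/-mkℚ k = normalize-coprime (1-coprimeTo (suc k))

/≡toℚ*1/ : ∀ a m .{{_ : NonZero m}} → + a / m ≡ toℚ a * (+ 1 / m)
/≡toℚ*1/ a (suc k) =
  trans (/-cong (sym (ℤ.*-identityʳ (+ a))) (sym (ℕ.*-identityˡ (suc k))))
        (sym (cong₂ _*_ (toℚ≡mkℚ a) (1/-mkℚ k)))

toℚ*1/≡1 : ∀ m .{{_ : NonZero m}} → toℚ m * (+ 1 / m) ≡ 1ℚ
toℚ*1/≡1 (suc k) =
  trans (cong₂ _*_ (toℚ≡mkℚ (suc k)) (1/-mkℚ k))
        (*-inverseʳ (mkℚ (+ suc k) 0 (coprime-sym (1-coprimeTo (suc k)))))

x≡-x⇒x≡0 : ∀ x → x ≡ - x → x ≡ 0ℚ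
x≡-x⇒x≡0 x x≡-x = begin
  x                         ≡⟨ solve 1 (λ y → y := con (+ 1 / 2) :* (y :+ y)) refl x ⟩
  + 1 / 2 * (x + x)         ≡⟨ cong (λ y → + 1 / 2 * (x + y)) x≡-x ⟩
  + 1 / 2 * (x + - x)       ≡⟨ solve 1 (λ y → con (+ 1 / 2) :* (y :+ :- y) := con 0ℚ) refl x ⟩
  0ℚ                        ∎
  where open ≡-Reasoning; open +-*-Solver

p≤∣p∣ : ∀ p → p ≤ ∣ p ∣
p≤∣p∣ p with ≤-total p 0ℚ
... | inj₁ p≤0 = ≤-trans p≤0 (0≤∣p∣ p)
... | inj₂ 0≤p = ≤-reflexive (sym (0≤p⇒∣p∣≡p 0≤p))

SkewSymmetric : ∀ {n} → (Fin n → Fin n → ℚ) → Set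
SkewSymmetric f = ∀ a b → f a b ≡ - f b a

Σℚ²-skew≡0 : ∀ {n} (g : Fin n → Fin n → ℚ) → SkewSymmetric g →
             Σℚ (λ u → Σℚ (λ a → g a u)) ≡ 0ℚ
Σℚ²-skew≡0 g skew = x≡-x⇒x≡0 _ (begin
  Σℚ (λ u → Σℚ (λ a → g a u))    ≡⟨ Σℚ-comm (λ u a → g a u) ⟩
  Σℚ (λ a → Σℚ (λ u → g a u))    ≡⟨ Σℚ-cong (λ a → Σℚ-cong (λ u → skew a u)) ⟩
  Σℚ (λ a → Σℚ (λ u → - g u a))  ≡⟨ Σℚ-cong (λ a → Σℚ-neg (λ u → g u a)) ⟩
  Σℚ (λ a → - Σℚ (λ u → g u a))  ≡⟨ Σℚ-neg (λ a → Σℚ (λ u → g u a)) ⟩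
  - Σℚ (λ a → Σℚ (λ u → g u a))  ∎)
  where open ≡-Reasoning

inside outside : ∀ {n} → VSet n → (Fin n → ℚ) → Fin n → ℚ
inside  S g u = if S u then g u else 0ℚ
outside S g u = if S u then 0ℚ else g u

Σℚ-split : ∀ {n} (S : VSet n) (g : Fin n → ℚ) → Σℚ g ≡ Σℚ (inside S g) + Σℚ (outside S g)
Σℚ-split S g = trans (Σℚ-cong split) (Σℚ-distrib-+ (inside S g) (outside S g))
  where
  split : ∀ u → g u ≡ inside S g u + outside S g u
  split u with S u
  ... | true  = sym (+-identityʳ (g u))
  ... | false = sym (+-identityˡ (g u))

Σℚ-outside : ∀ {n} (S : VSet n) (g : Fin n → ℚ) → Σℚ (outside S g) ≡ Σℚ g - Σℚ (inside S g)
Σℚ-outside S g = begin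
  Σℚ (outside S g)
    ≡⟨ solve 2 (λ i o → o := (i :+ o) :- i) refl (Σℚ (inside S g)) (Σℚ (outside S g)) ⟩
  Σℚ (inside S g) + Σℚ (outside S g) - Σℚ (inside S g)
    ≡⟨ cong (_- Σℚ (inside S g)) (Σℚ-split S g) ⟨
  Σℚ g - Σℚ (inside S g) ∎
  where open ≡-Reasoning; open +-*-Solver

flowInto : ∀ {n} → VSet n → (Fin n → Fin n → ℚ) → ℚ
flowInto S f = Σℚ (inside S (λ u → Σℚ (outside S (λ a → f a u))))

Σℚ-excess : ∀ {n} (Δ : Fin n → ℚ) (f : Fin n → Fin n → ℚ) → SkewSymmetric f →
            Σℚ (excess Δ f) ≡ Σℚ Δ
Σℚ-excess Δ f skew = begin
  Σℚ (excess Δ f)                         ≡⟨ Σℚ-distrib-+ Δ (λ u → Σℚ (λ a → f a u)) ⟩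
  Σℚ Δ + Σℚ (λ u → Σℚ (λ a → f a u))      ≡⟨ cong (_+_ (Σℚ Δ)) (Σℚ²-skew≡0 f skew) ⟩
  Σℚ Δ + 0ℚ                               ≡⟨ +-identityʳ (Σℚ Δ) ⟩
  Σℚ Δ                                    ∎
  where open ≡-Reasoning

Σℚ-inside-excess : ∀ {n} (Δ : Fin n → ℚ) (f : Fin n → Fin n → ℚ) → SkewSymmetric f →
                   (S : VSet n) → Σℚ (inside S (excess Δ f)) ≡ Σℚ (inside S Δ) + flowInto S f
Σℚ-inside-excess {n} Δ f skew S = begin
  Σℚ (inside S (excess Δ f))
    ≡⟨ Σℚ-cong split ⟩
  Σℚ (λ u → inside S Δ u + (Σℚ (λ a → fInside a u) + into u))
    ≡⟨ Σℚ-distrib-+ (inside S Δ) _ ⟩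
  Σℚ (inside S Δ) + Σℚ (λ u → Σℚ (λ a → fInside a u) + into u)
    ≡⟨ cong (_+_ (Σℚ (inside S Δ))) (Σℚ-distrib-+ (λ u → Σℚ (λ a → fInside a u)) into) ⟩
  Σℚ (inside S Δ) + (Σℚ (λ u → Σℚ (λ a → fInside a u)) + flowInto S f)
    ≡⟨ cong (λ x → Σℚ (inside S Δ) + (x + flowInto S f)) (Σℚ²-skew≡0 fInside fInside-skew) ⟩
  Σℚ (inside S Δ) + (0ℚ + flowInto S f)
    ≡⟨ cong (_+_ (Σℚ (inside S Δ))) (+-identityˡ (flowInto S f)) ⟩
  Σℚ (inside S Δ) + flowInto S f ∎
  where
  open ≡-Reasoning
  fInside : Fin n → Fin n → ℚ
  fInside a u = if S u then (if S a then f a u else 0ℚ) else 0ℚ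
  into : Fin n → ℚ
  into = inside S (λ u → Σℚ (outside S (λ a → f a u)))
  fInside-skew : SkewSymmetric fInside
  fInside-skew a b with S a | S b
  ... | true  | true  = skew a b
  ... | true  | false = refl
  ... | false | true  = refl
  ... | false | false = refl
  split : ∀ u → inside S (excess Δ f) u ≡ inside S Δ u + (Σℚ (λ a → fInside a u) + into u)
  split u with S u
  ... | true  = cong (_+_ (Δ u)) (Σℚ-split S (λ a → f a u))
  ... | false = sym (trans (+-identityˡ _) (trans (+-identityʳ _) (Σℚ-zero n)))

toℚ-vol : ∀ {n} (C : Multigraph n) (S : VSet n) → toℚ (vol C S) ≡ Σℚ (inside S (toℚ ∘ deg C))
toℚ-vol C S =
  trans (toℚ-Σℕ (λ u → if S u then deg C u else 0)) (Σℚ-cong (λ u → if-float toℚ (S u)))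

toℚ-boundary : ∀ {n} (C : Multigraph n) (S : VSet n) →
               toℚ (boundary C S) ≡ Σℚ (inside S (λ u → Σℚ (outside S (toℚ ∘ mult C u))))
toℚ-boundary {n} C S =
  trans (toℚ-Σℕ (λ u → if S u then Σℕ (cutℕ u) else 0)) (Σℚ-cong toℚ-inside)
  where
  cutℕ : Fin n → Fin n → ℕ
  cutℕ u w = if S w then 0 else mult C u w
  toℚ-inside : ∀ u → toℚ (if S u then Σℕ (cutℕ u) else 0)
                     ≡ inside S (λ u → Σℚ (outside S (toℚ ∘ mult C u))) u
  toℚ-inside u =
    trans (if-float toℚ (S u))
          (cong (λ x → if S u then x else 0ℚ)
                (trans (toℚ-Σℕ (cutℕ u)) (Σℚ-cong (λ w → if-float toℚ (S w)))))

flowInto-≥ : ∀ {n} (C : Multigraph n) (cap : ℚ) (f : Fin n → Fin n → ℚ) → SkewSymmetric f →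
             (∀ a b → ∣ f a b ∣ ≤ toℚ (mult C a b) * cap) → (S : VSet n) →
             - cap * toℚ (boundary C S) ≤ flowInto S f
flowInto-≥ {n} C cap f skew capacity S = begin
  - cap * toℚ (boundary C S)
    ≡⟨ cong (- cap *_) (toℚ-boundary C S) ⟩
  - cap * Σℚ (inside S cut)
    ≡⟨ Σℚ-distribˡ-* (- cap) (inside S cut) ⟨
  Σℚ (λ u → - cap * inside S cut u)
    ≤⟨ Σℚ-mono-≤ bound ⟩
  flowInto S f ∎
  where
  open ≤-Reasoning
  cut : Fin n → ℚ
  cut u = Σℚ (outside S (toℚ ∘ mult C u))
  edge : ∀ a u → - cap * toℚ (mult C u a) ≤ f a u
  edge a u = begin
    - cap * toℚ (mult C u a)    ≡⟨ trans (cong -_ (*-comm _ cap)) (neg-distribˡ-* cap _) ⟨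
    - (toℚ (mult C u a) * cap)  ≤⟨ neg-antimono-≤ (≤-trans (p≤∣p∣ (f u a)) (capacity u a)) ⟩
    - f u a                     ≡⟨ skew a u ⟨
    f a u                       ∎
  bound : ∀ u → - cap * inside S cut u ≤ inside S (λ u → Σℚ (outside S (λ a → f a u))) u
  bound u with S u
  ... | false = ≤-reflexive (*-zeroʳ (- cap))
  ... | true  = ≤-trans (≤-reflexive (sym (Σℚ-distribˡ-* (- cap) (outside S (toℚ ∘ mult C u)))))
                        (Σℚ-mono-≤ boundEdge)
    where
    boundEdge : ∀ a → - cap * outside S (toℚ ∘ mult C u) a ≤ outside S (λ a → f a u) a
    boundEdge a with S a
    ... | true  = ≤-reflexive (*-zeroʳ (- cap))
    ... | false = edge a u

routed-≤-inside-deg+outside-excess : ∀ {n} (C : Multigraph n) (Δ : Fin n → ℚ)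
  (f : Fin n → Fin n → ℚ) (S : VSet n) →
  routed C Δ f ≤ Σℚ (inside S (toℚ ∘ deg C)) + Σℚ (outside S (excess Δ f))
routed-≤-inside-deg+outside-excess C Δ f S =
  ≤-trans (Σℚ-mono-≤ bound) (≤-reflexive (Σℚ-distrib-+ (inside S (toℚ ∘ deg C)) _))
  where
  bound : ∀ u → excess Δ f u ⊓ toℚ (deg C u)
                ≤ inside S (toℚ ∘ deg C) u + outside S (excess Δ f) u
  bound u with S u
  ... | true  = ≤-trans (p⊓q≤q (excess Δ f u) (toℚ (deg C u))) (≤-reflexive (sym (+-identityʳ _)))
  ... | false = ≤-trans (p⊓q≤p (excess Δ f u) (toℚ (deg C u))) (≤-reflexive (sym (+-identityˡ _)))

routed-≤ : ∀ {n} (C : Multigraph n) (cap : ℚ) (Δ : Fin n → ℚ) (f : Fin n → Fin n → ℚ) →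
           SkewSymmetric f → (∀ a b → ∣ f a b ∣ ≤ toℚ (mult C a b) * cap) → (S : VSet n) →
           routed C Δ f ≤ toℚ (vol C S) + Σℚ (outside S Δ) + cap * toℚ (boundary C S)
routed-≤ C cap Δ f skew capacity S = begin
  routed C Δ f
    ≤⟨ routed-≤-inside-deg+outside-excess C Δ f S ⟩
  Σℚ (inside S (toℚ ∘ deg C)) + Σℚ (outside S (excess Δ f))
    ≡⟨ cong₂ _+_ (sym (toℚ-vol C S)) (Σℚ-outside S (excess Δ f)) ⟩
  V + (Σℚ (excess Δ f) - Σℚ (inside S (excess Δ f)))
    ≡⟨ cong₂ (λ x y → V + (x - y)) (Σℚ-excess Δ f skew) (Σℚ-inside-excess Δ f skew S) ⟩
  V + (Σℚ Δ - (Σℚ (inside S Δ) + flowInto S f))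
    ≤⟨ +-monoʳ-≤ V (+-monoʳ-≤ (Σℚ Δ) (neg-antimono-≤ (+-monoʳ-≤ (Σℚ (inside S Δ)) inflow≥))) ⟩
  V + (Σℚ Δ - (Σℚ (inside S Δ) + - cap * B))
    ≡⟨ solve 5 (λ v t i k b → v :+ (t :- (i :+ :- k :* b)) := v :+ (t :- i) :+ k :* b)
               refl V (Σℚ Δ) (Σℚ (inside S Δ)) cap B ⟩
  V + (Σℚ Δ - Σℚ (inside S Δ)) + cap * B
    ≡⟨ cong (λ x → V + x + cap * B) (Σℚ-outside S Δ) ⟨
  V + Σℚ (outside S Δ) + cap * B ∎
  where
  open ≤-Reasoning; open +-*-Solver
  V B : ℚ
  V = toℚ (vol C S)
  B = toℚ (boundary C S)
  inflow≥ : - cap * B ≤ flowInto S f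
  inflow≥ = flowInto-≥ C cap f skew capacity S

Σℚ-inside-source : ∀ {n} (X : Fin n → ℕ) .{{_ : NonZero (size X)}} (σ : ℚ) (S : VSet n) →
                   Σℚ (inside S (source X σ)) ≡ σ * (+ 1 / size X * toℚ (inSet S X))
Σℚ-inside-source {n} X σ S = begin
  Σℚ (inside S (source X σ))                 ≡⟨ Σℚ-cong share ⟩
  Σℚ (λ u → σ * (w * toℚ (Xˢ u)))            ≡⟨ Σℚ-distribˡ-* σ (λ u → w * toℚ (Xˢ u)) ⟩
  σ * Σℚ (λ u → w * toℚ (Xˢ u))              ≡⟨ cong (σ *_) (Σℚ-distribˡ-* w (toℚ ∘ Xˢ)) ⟩
  σ * (w * Σℚ (toℚ ∘ Xˢ))                    ≡⟨ cong (λ x → σ * (w * x)) (toℚ-Σℕ Xˢ) ⟨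
  σ * (w * toℚ (inSet S X))                  ∎
  where
  open ≡-Reasoning
  w : ℚ
  w = + 1 / size X
  Xˢ : Fin n → ℕ
  Xˢ u = if S u then X u else 0
  share : ∀ u → inside S (source X σ) u ≡ σ * (w * toℚ (Xˢ u))
  share u with S u
  ... | true  = cong (σ *_) (trans (/≡toℚ*1/ (X u) (size X)) (*-comm (toℚ (X u)) w))
  ... | false = sym (trans (cong (σ *_) (*-zeroʳ w)) (*-zeroʳ σ))

Σℚ-source : ∀ {n} (X : Fin n → ℕ) .{{_ : NonZero (size X)}} (σ : ℚ) → Σℚ (source X σ) ≡ σ
Σℚ-source X σ = begin
  Σℚ (source X σ)                      ≡⟨ Σℚ-inside-source X σ (λ _ → true) ⟩
  σ * (+ 1 / size X * toℚ (size X))    ≡⟨ cong (σ *_) (*-comm (+ 1 / size X) (toℚ (size X))) ⟩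
  σ * (toℚ (size X) * (+ 1 / size X))  ≡⟨ cong (σ *_) (toℚ*1/≡1 (size X)) ⟩
  σ * 1ℚ                               ≡⟨ *-identityʳ σ ⟩
  σ                                    ∎
  where open ≡-Reasoning

Σℚ-outside-source-≤ : ∀ {n} (X : Fin n → ℕ) .{{_ : NonZero (size X)}} (σ : ℚ) (S : VSet n) →
                      0ℚ ≤ σ → + 3 / 4 * toℚ (size X) ≤ toℚ (inSet S X) →
                      Σℚ (outside S (source X σ)) ≤ σ * (+ 1 / 4)
Σℚ-outside-source-≤ X σ S 0≤σ captured = begin
  Σℚ (outside S (source X σ))          ≡⟨ Σℚ-outside S (source X σ) ⟩
  Σℚ (source X σ) - Σℚ (inside S (source X σ))
                                       ≡⟨ cong₂ _-_ (Σℚ-source X σ) (Σℚ-inside-source X σ S) ⟩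
  σ - σ * (w * toℚ (inSet S X))
    ≤⟨ +-monoʳ-≤ σ (neg-antimono-≤ (*-monoˡ-≤-nonNeg σ {{nonNegative 0≤σ}} fraction≥)) ⟩
  σ - σ * (+ 3 / 4)
    ≡⟨ solve 1 (λ x → x :- x :* con (+ 3 / 4) := x :* con (+ 1 / 4)) refl σ ⟩
  σ * (+ 1 / 4) ∎
  where
  open ≤-Reasoning; open +-*-Solver
  w : ℚ
  w = + 1 / size X
  fraction≥ : + 3 / 4 ≤ w * toℚ (inSet S X)
  fraction≥ = begin
    + 3 / 4                        ≡⟨ *-identityʳ (+ 3 / 4) ⟨
    + 3 / 4 * 1ℚ                   ≡⟨ cong (+ 3 / 4 *_) (toℚ*1/≡1 (size X)) ⟨
    + 3 / 4 * (toℚ (size X) * w)   ≡⟨ solve 3 (λ a b c → a :* (b :* c) := c :* (a :* b))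
                                            refl (+ 3 / 4) (toℚ (size X)) w ⟩
    w * (+ 3 / 4 * toℚ (size X))   ≤⟨ *-monoˡ-≤-nonNeg w {{normalize-nonNeg 1 (size X)}} captured ⟩
    w * toℚ (inSet S X)            ∎

edgeCap*δ : ∀ s δ (δ>0 : 0ℚ < δ) → edgeCap s δ δ>0 * δ ≡ s * (+ 1 / 1000)
edgeCap*δ s δ δ>0 = begin
  s * δ⁻¹ * c * δ      ≡⟨ solve 4 (λ x i k d → x :* i :* k :* d := x :* k :* (d :* i))
                                refl s δ⁻¹ c δ ⟩
  s * c * (δ * δ⁻¹)    ≡⟨ cong (s * c *_) (*-inverseʳ δ {{δ≢0}}) ⟩
  s * c * 1ℚ           ≡⟨ *-identityʳ (s * c) ⟩
  s * c                ∎
  where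
  open ≡-Reasoning; open +-*-Solver
  δ≢0 : ℚ.NonZero δ
  δ≢0 = pos⇒nonZero δ {{positive δ>0}}
  δ⁻¹ c : ℚ
  δ⁻¹ = (1/ δ) {{δ≢0}}
  c = + 1 / 1000

edgeCap*≤ : ∀ {s δ k} (δ>0 : 0ℚ < δ) → 0ℚ ≤ s → k ≤ δ → edgeCap s δ δ>0 * k ≤ s * (+ 1 / 1000)
edgeCap*≤ {s} {δ} {k} δ>0 0≤s k≤δ = begin
  edgeCap s δ δ>0 * k   ≤⟨ *-monoˡ-≤-nonNeg (edgeCap s δ δ>0) {{nonNegative 0≤cap}} k≤δ ⟩
  edgeCap s δ δ>0 * δ   ≡⟨ edgeCap*δ s δ δ>0 ⟩
  s * (+ 1 / 1000)      ∎
  where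
  open ≤-Reasoning
  0≤cap : 0ℚ ≤ edgeCap s δ δ>0
  0≤cap = *-cancelʳ-≤-pos δ {{positive δ>0}} (begin
    0ℚ * δ                ≡⟨ *-zeroˡ δ ⟩
    0ℚ                    ≡⟨ *-zeroˡ (+ 1 / 1000) ⟨
    0ℚ * (+ 1 / 1000)     ≤⟨ *-monoʳ-≤-nonNeg (+ 1 / 1000) 0≤s ⟩
    s * (+ 1 / 1000)      ≡⟨ edgeCap*δ s δ δ>0 ⟨
    edgeCap s δ δ>0 * δ   ∎)

lemma13 : {n : ℕ} (C : Multigraph n) (δ s₀ s : ℚ)
            (δ>0 : 0ℚ < δ) (s₀>0 : 0ℚ < s₀) (s>0 : 0ℚ < s)
            (v : Fin n) (X : Fin n → ℕ) {{_ : NonZero (size X)}}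
            → IsBundle C v X
            → Captured C δ s₀ s v X
            → (f : Fin n → Fin n → ℚ)
            → FeasiblePreflow C (edgeCap s δ δ>0) (source X ((+ 2 / 1) * s)) f
            → routed C (source X ((+ 2 / 1) * s)) f ≤ (+ 8 / 5) * s
lemma13 C δ _ s δ>0 _ s>0 _ X _ (S , ∂S≤δ , _ , volS≤s , captured) f (skew , capacity , _) = begin
  routed C Δ f
    ≤⟨ routed-≤ C cap Δ f skew capacity S ⟩
  toℚ (vol C S) + Σℚ (outside S Δ) + cap * toℚ (boundary C S)
    ≤⟨ +-mono-≤ (+-mono-≤ volS≤s (Σℚ-outside-source-≤ X σ S 0≤σ captured))
                (edgeCap*≤ δ>0 0≤s ∂S≤δ) ⟩
  s + σ * (+ 1 / 4) + s * (+ 1 / 1000)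
    ≡⟨ solve 1 (λ x → x :+ con (+ 2 / 1) :* x :* con (+ 1 / 4) :+ x :* con (+ 1 / 1000)
                      := con (+ 1501 / 1000) :* x) refl s ⟩
  + 1501 / 1000 * s
    ≤⟨ *-monoʳ-≤-nonNeg s {{nonNegative 0≤s}} {+ 1501 / 1000} {+ 8 / 5} (≤ᵇ⇒≤ _) ⟩
  + 8 / 5 * s ∎
  where
  open ≤-Reasoning; open +-*-Solver
  σ cap : ℚ
  σ = + 2 / 1 * s
  cap = edgeCap s δ δ>0
  Δ : Fin _ → ℚ
  Δ = source X σ
  0≤s : 0ℚ ≤ s
  0≤s = <⇒≤ s>0
  0≤σ : 0ℚ ≤ σ
  0≤σ = ≤-trans (≤-reflexive (sym (*-zeroʳ (+ 2 / 1)))) (*-monoˡ-≤-nonNeg (+ 2 / 1) 0≤s)
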